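{- Let $a,b,p,q$ be complex numbers with $p\neq 0$, $q\neq 0$. For every non-negative integer $k$ and every integer $m$: \[ (-qu_{r-1})^k\sum_{j=0}^k\binom kj\left(-\frac{u_r}{qu_{r-1}}\right)^j w_{m-k(r+1)+j} = w_m\qquad (r\in\mathbb{Z},\ r\neq 0), \] \[ \sum_{j=0}^k\binom kj\frac{w_{m-k+rj}}{(qu_{r-2})^j} = \left(\frac{u_{r-1}}{qu_{r-2}}\right)^k w_m\qquad (r\in\mathbb{Z},\ r\neq 1), \] \[ \sum_{j=0}^k(-1)^j\binom kj\frac{w_{m+k+rj}}{u_r^j} = \left(\frac{qu_{r-1}}{u_r}\right)^k w_m\qquad (r\in\mathbb{Z},\ r\neq -1). \]
   Context: The sequence $\{w_n\}=\{w_n(a,b;p,q)\}$ is defined by $w_0=a$, $w_1=b$, $w_n=pw_{n-1}-qw_{n-2}$ for $n\ge 2$, and extended to negative indices by $w_{ -n}=(pw_{ -n+1}-w_{ -n+2})/q$, so that $w_n=pw_{n-1}-qw_{n-2}$ holds for all integers $n$. The sequence $u_n=u_n(p,q)$ is $w_n(1,p;p,q)$, i.e. $u_0=1$, $u_1=p$, $u_n=pu_{n-1}-qu_{n-2}$ for all integers $n$ (so in particular $u_{ -1}=0$). -}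

module Defs where

open import Level using (Level; _⊔_) renaming (suc to lsuc)
open import Algebra.Bundles using (CommutativeRing)
open import Data.Nat using (ℕ; zero; suc)
open import Data.Nat.Combinatorics using (_C_)
open import Data.Integer as ℤ using (ℤ; +_; -[1+_])
open import Data.Product using (_×_; _,_; proj₁)
open import Relation.Nullary using (¬_)

-- A field: a commutative ring with 0 ≠ 1 in which every nonzero element
-- has a multiplicative inverse (the inverse map is total; its value at 0
-- is irrelevant).  The complex numbers are an instance.
record Field (c ℓ : Level) : Set (lsuc (c ⊔ ℓ)) where
  field
    commutativeRing : CommutativeRing c ℓ
  open CommutativeRing commutativeRing public
  field
    _⁻¹      : Carrier → Carrier
    inverseʳ : ∀ x → ¬ (x ≈ 0#) → (x * (x ⁻¹)) ≈ 1#
    0≉1      : ¬ (0# ≈ 1#)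

module _ {c ℓ : Level} (F : Field c ℓ) where
  open Field F using (Carrier; _≈_; _+_; _*_; -_; _-_; 0#; 1#; _⁻¹)

  _÷_ : Carrier → Carrier → Carrier
  x ÷ y = x * (y ⁻¹)

  pow : Carrier → ℕ → Carrier
  pow x zero    = 1#
  pow x (suc n) = x * pow x n

  ι : ℕ → Carrier
  ι zero    = 0#
  ι (suc n) = 1# + ι n

  sumTo : ℕ → (ℕ → Carrier) → Carrier
  sumTo zero    f = f zero
  sumTo (suc k) f = sumTo k f + f (suc k)

  binom : ℕ → ℕ → Carrier
  binom k j = ι (k C j)

  module _ (a b p q : Carrier) where
    -- (w_n , w_{n+1}) for n ≥ 0
    wPos : ℕ → Carrier × Carrier
    wPos zero    = a , b
    wPos (suc n) with wPos n
    ... | (x , y) = y , ((p * y) - (q * x))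

    -- (w_{-n} , w_{-n+1}) for n ≥ 0, using w_{-n} = (p w_{-n+1} - w_{-n+2})/q
    wNeg : ℕ → Carrier × Carrier
    wNeg zero    = a , b
    wNeg (suc n) with wNeg n
    ... | (x , y) = (((p * x) - y) ÷ q) , x

    w : ℤ → Carrier
    w (+ n)      = proj₁ (wPos n)
    w -[1+ n ]   = proj₁ (wNeg (suc n))

  u : Carrier → Carrier → ℤ → Carrier
  u p q = w 1# p p q

-- Extended to all integer indices, the recurrence yields the addition formula
-- w_{m+1+i} = u_i w_{m+1} - q u_{i-1} w_m: both sides solve the recurrence in i
-- and agree at i = 0, 1.  In each of the three identities the addition formula
-- reads w_n + c w_{n+s} = d w_{n+t} for suitable c, d, s, t, i.e.
-- (1 + c E^s) w = d E^t w for the shift E.  Raising this to the k-th power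
-- with the binomial theorem gives Σ_j C(k,j) c^j w_{n+sj} = d^k w_{n+tk},
-- which is each identity after reindexing.
module Submission where

open import Defs
open import Level using (Level)
open import Algebra.Bundles using (CommutativeRing)
open import Data.Nat as ℕ using (ℕ; zero; suc)
import Data.Nat.Properties as ℕP
open import Data.Integer as ℤ using (ℤ; +_; -[1+_]; _⊖_; _◃_; 0ℤ)
import Data.Integer.Properties as ℤP
import Data.Sign as Sign
open import Data.Integer.Tactic.RingSolver using (solve-∀)
open import Data.Nat.Combinatorics using (_C_; nCk+nC[k+1]≡[n+1]C[k+1]; k>n⇒nCk≡0)
open import Data.Maybe using (Maybe; map)
open import Data.Product using (_×_; _,_; proj₁)
open import Relation.Binary.Consequences using (dec⇒weaklyDec)
open import Relation.Binary.PropositionalEquality as ≡ using (_≡_; _≢_)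


-- Algebra.Solver.Ring needs coefficients with decidable equality, so we
-- interpret ℤ in an arbitrary commutative ring.
module IntegerCoefficients {c ℓ : Level} (R : CommutativeRing c ℓ) where
  open CommutativeRing R
  open import Algebra.Definitions.RawMonoid +-rawMonoid using () renaming (_×_ to _·_)
  open import Algebra.Properties.Monoid.Mult +-monoid using (×-homo-+)
  open import Algebra.Properties.Semiring.Mult semiring using (×1-homo-*)
  open import Algebra.Properties.Ring ring using (-‿distribˡ-*; -‿distribʳ-*)
  open import Algebra.Properties.AbelianGroup +-abelianGroup using (⁻¹-∙-comm)
  open import Algebra.Properties.Group +-group using (ε⁻¹≈ε; ⁻¹-involutive)
  open import Algebra.Properties.CommutativeSemigroup +-commutativeSemigroup using (interchange)
  open import Algebra.Solver.Ring.AlmostCommutativeRing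
    using (_-Raw-AlmostCommutative⟶_; fromCommutativeRing)
  open import Relation.Binary.Reasoning.Setoid setoid

  ⟦_⟧ : ℤ → Carrier
  ⟦ + n ⟧      = n · 1#
  ⟦ -[1+ n ] ⟧ = - (suc n · 1#)

  ⟦⊖⟧ : ∀ m n → ⟦ m ⊖ n ⟧ ≈ m · 1# - n · 1#
  ⟦⊖⟧ m       zero    = sym (trans (+-congˡ ε⁻¹≈ε) (+-identityʳ _))
  ⟦⊖⟧ zero    (suc n) = sym (+-identityˡ _)
  ⟦⊖⟧ (suc m) (suc n) = begin
    ⟦ suc m ⊖ suc n ⟧                      ≡⟨ ≡.cong ⟦_⟧ (ℤP.[1+m]⊖[1+n]≡m⊖n m n) ⟩
    ⟦ m ⊖ n ⟧                              ≈⟨ ⟦⊖⟧ m n ⟩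
    m · 1# - n · 1#                        ≈⟨ +-identityˡ _ ⟨
    0# + (m · 1# - n · 1#)                 ≈⟨ +-congʳ (-‿inverseʳ 1#) ⟨
    (1# - 1#) + (m · 1# - n · 1#)          ≈⟨ interchange 1# (- 1#) (m · 1#) (- (n · 1#)) ⟩
    (1# + m · 1#) + (- 1# - n · 1#)        ≈⟨ +-congˡ (⁻¹-∙-comm 1# (n · 1#)) ⟩
    suc m · 1# - suc n · 1#                ∎

  ⟦+◃⟧ : ∀ n → ⟦ Sign.+ ◃ n ⟧ ≈ n · 1#
  ⟦+◃⟧ zero    = refl
  ⟦+◃⟧ (suc n) = refl

  ⟦-◃⟧ : ∀ n → ⟦ Sign.- ◃ n ⟧ ≈ - (n · 1#)
  ⟦-◃⟧ zero    = sym ε⁻¹≈ε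
  ⟦-◃⟧ (suc n) = refl

  ⟦+⟧ : ∀ i j → ⟦ i ℤ.+ j ⟧ ≈ ⟦ i ⟧ + ⟦ j ⟧
  ⟦+⟧ (+ m)      (+ n)      = ×-homo-+ 1# m n
  ⟦+⟧ (+ m)      -[1+ n ]   = ⟦⊖⟧ m (suc n)
  ⟦+⟧ -[1+ m ]   (+ n)      = trans (⟦⊖⟧ n (suc m)) (+-comm _ _)
  ⟦+⟧ -[1+ m ]   -[1+ n ]   = begin
    - (suc (suc (m ℕ.+ n)) · 1#)           ≡⟨ ≡.cong (λ k → - (k · 1#)) (ℕP.+-suc (suc m) n) ⟨
    - ((suc m ℕ.+ suc n) · 1#)             ≈⟨ -‿cong (×-homo-+ 1# (suc m) (suc n)) ⟩
    - (suc m · 1# + suc n · 1#)            ≈⟨ ⁻¹-∙-comm _ _ ⟨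
    - (suc m · 1#) - suc n · 1#            ∎

  ⟦*⟧ : ∀ i j → ⟦ i ℤ.* j ⟧ ≈ ⟦ i ⟧ * ⟦ j ⟧
  ⟦*⟧ (+ m)      (+ n)      = trans (⟦+◃⟧ (m ℕ.* n)) (×1-homo-* m n)
  ⟦*⟧ (+ m)      -[1+ n ]   = begin
    ⟦ Sign.- ◃ m ℕ.* suc n ⟧               ≈⟨ ⟦-◃⟧ (m ℕ.* suc n) ⟩
    - ((m ℕ.* suc n) · 1#)                 ≈⟨ -‿cong (×1-homo-* m (suc n)) ⟩
    - (m · 1# * suc n · 1#)                ≈⟨ -‿distribʳ-* _ _ ⟩
    m · 1# * - (suc n · 1#)                ∎
  ⟦*⟧ -[1+ m ]   (+ n)      = begin
    ⟦ Sign.- ◃ suc m ℕ.* n ⟧               ≈⟨ ⟦-◃⟧ (suc m ℕ.* n) ⟩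
    - ((suc m ℕ.* n) · 1#)                 ≈⟨ -‿cong (×1-homo-* (suc m) n) ⟩
    - (suc m · 1# * n · 1#)                ≈⟨ -‿distribˡ-* _ _ ⟩
    - (suc m · 1#) * n · 1#                ∎
  ⟦*⟧ -[1+ m ]   -[1+ n ]   = begin
    ⟦ Sign.+ ◃ suc m ℕ.* suc n ⟧           ≈⟨ ⟦+◃⟧ (suc m ℕ.* suc n) ⟩
    (suc m ℕ.* suc n) · 1#                 ≈⟨ ×1-homo-* (suc m) (suc n) ⟩
    x * y                                  ≈⟨ ⁻¹-involutive _ ⟨
    - - (x * y)                            ≈⟨ -‿cong (-‿distribˡ-* x y) ⟩
    - (- x * y)                            ≈⟨ -‿distribʳ-* (- x) y ⟩
    - x * - y                              ∎
    where x = suc m · 1#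
          y = suc n · 1#

  ⟦-⟧ : ∀ i → ⟦ ℤ.- i ⟧ ≈ - ⟦ i ⟧
  ⟦-⟧ (+ zero)  = sym ε⁻¹≈ε
  ⟦-⟧ (+ suc n) = refl
  ⟦-⟧ -[1+ n ]  = sym (⁻¹-involutive _)

  ℤ⟶R : CommutativeRing.rawRing ℤP.+-*-commutativeRing -Raw-AlmostCommutative⟶ fromCommutativeRing R
  ℤ⟶R = record
    { ⟦_⟧    = ⟦_⟧
    ; +-homo = ⟦+⟧
    ; *-homo = ⟦*⟧
    ; -‿homo = ⟦-⟧
    ; 0-homo = refl
    ; 1-homo = +-identityʳ 1#
    }

  ⟦⟧-≟ : ∀ i j → Maybe (⟦ i ⟧ ≈ ⟦ j ⟧)
  ⟦⟧-≟ i j = map (λ { ≡.refl → refl }) (dec⇒weaklyDec ℤP._≟_ i j)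

  open import Algebra.Solver.Ring _ (fromCommutativeRing R) ℤ⟶R ⟦⟧-≟ public
    using (solve; _:=_; _:+_; _:*_; _:-_; :-_; con)

module _ {ℓ₁ ℓ₂ : Level} (F : Field ℓ₁ ℓ₂) where
  open Field F
  open IntegerCoefficients commutativeRing
  open import Algebra.Properties.Ring ring using (-1*x≈-x)
  open import Algebra.Properties.Group +-group using (ε⁻¹≈ε; ⁻¹-involutive)
  open import Algebra.Properties.CommutativeSemigroup +-commutativeSemigroup
    using () renaming (interchange to +-interchange)
  open import Algebra.Properties.CommutativeSemigroup *-commutativeSemigroup
    using () renaming (interchange to *-interchange; x∙yz≈yx∙z to x*yz≈yx*z)
  open import Relation.Binary.Reasoning.Setoid setoid

  *-cancelˡ-≉0 : ∀ {x y z} → x ≉ 0# → x * y ≈ x * z → y ≈ z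
  *-cancelˡ-≉0 {x} {y} {z} x≉0 xy≈xz = begin
    y                   ≈⟨ *-identityˡ y ⟨
    1# * y              ≈⟨ *-congʳ (trans (*-comm _ _) (inverseʳ x x≉0)) ⟨
    x ⁻¹ * x * y        ≈⟨ *-assoc _ _ _ ⟩
    x ⁻¹ * (x * y)      ≈⟨ *-congˡ xy≈xz ⟩
    x ⁻¹ * (x * z)      ≈⟨ *-assoc _ _ _ ⟨
    x ⁻¹ * x * z        ≈⟨ *-congʳ (trans (*-comm _ _) (inverseʳ x x≉0)) ⟩
    1# * z              ≈⟨ *-identityˡ z ⟩
    z                   ∎

  x*y≈z⇒y≈x⁻¹*z : ∀ {x y z} → x ≉ 0# → x * y ≈ z → y ≈ x ⁻¹ * z
  x*y≈z⇒y≈x⁻¹*z {x} {y} {z} x≉0 xy≈z = *-cancelˡ-≉0 x≉0 (begin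
    x * y               ≈⟨ xy≈z ⟩
    z                   ≈⟨ *-identityˡ z ⟨
    1# * z              ≈⟨ *-congʳ (inverseʳ x x≉0) ⟨
    x * x ⁻¹ * z        ≈⟨ *-assoc _ _ _ ⟩
    x * (x ⁻¹ * z)      ∎)

  x*[y÷x]≈y : ∀ {x} y → x ≉ 0# → x * _÷_ F y x ≈ y
  x*[y÷x]≈y {x} y x≉0 = begin
    x * (y * x ⁻¹)      ≈⟨ solve 3 (λ x y z → x :* (y :* z) := y :* (x :* z)) refl x y (x ⁻¹) ⟩
    y * (x * x ⁻¹)      ≈⟨ *-congˡ (inverseʳ x x≉0) ⟩
    y * 1#              ≈⟨ *-identityʳ y ⟩
    y                   ∎

  *-≉0 : ∀ {x y} → x ≉ 0# → y ≉ 0# → x * y ≉ 0#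
  *-≉0 {x} x≉0 y≉0 xy≈0 = y≉0 (*-cancelˡ-≉0 x≉0 (trans xy≈0 (sym (zeroʳ x))))

  -‿≉0 : ∀ {x} → x ≉ 0# → - x ≉ 0#
  -‿≉0 {x} x≉0 -x≈0 = x≉0 (begin
    x                   ≈⟨ ⁻¹-involutive x ⟨
    - - x               ≈⟨ -‿cong -x≈0 ⟩
    - 0#                ≈⟨ ε⁻¹≈ε ⟩
    0#                  ∎)

  inverse-unique : ∀ {x y} → x * y ≈ 1# → y ≈ x ⁻¹
  inverse-unique {x} {y} xy≈1 = begin
    y                   ≈⟨ *-identityʳ y ⟨
    y * 1#              ≈⟨ *-congˡ (inverseʳ x x≉0) ⟨
    y * (x * x ⁻¹)      ≈⟨ solve 3 (λ x y z → y :* (x :* z) := x :* y :* z) refl x y (x ⁻¹) ⟩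
    x * y * x ⁻¹        ≈⟨ *-congʳ xy≈1 ⟩
    1# * x ⁻¹           ≈⟨ *-identityˡ _ ⟩
    x ⁻¹                ∎
    where
    x≉0 : x ≉ 0#
    x≉0 x≈0 = 0≉1 (trans (sym (zeroˡ y)) (trans (*-congʳ (sym x≈0)) xy≈1))

  pow-congˡ : ∀ {x y} n → x ≈ y → pow F x n ≈ pow F y n
  pow-congˡ zero    x≈y = refl
  pow-congˡ (suc n) x≈y = *-cong x≈y (pow-congˡ n x≈y)

  pow-distrib-* : ∀ x y n → pow F (x * y) n ≈ pow F x n * pow F y n
  pow-distrib-* x y zero    = sym (*-identityˡ 1#)
  pow-distrib-* x y (suc n) =
    trans (*-congˡ (pow-distrib-* x y n)) (*-interchange x y (pow F x n) (pow F y n))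

  1^n≈1 : ∀ n → pow F 1# n ≈ 1#
  1^n≈1 zero    = refl
  1^n≈1 (suc n) = trans (*-identityˡ _) (1^n≈1 n)

  x^n*x⁻¹^n≈1 : ∀ {x} n → x ≉ 0# → pow F x n * pow F (x ⁻¹) n ≈ 1#
  x^n*x⁻¹^n≈1 {x} n x≉0 = begin
    pow F x n * pow F (x ⁻¹) n    ≈⟨ pow-distrib-* x (x ⁻¹) n ⟨
    pow F (x * x ⁻¹) n            ≈⟨ pow-congˡ n (inverseʳ x x≉0) ⟩
    pow F 1# n                    ≈⟨ 1^n≈1 n ⟩
    1#                            ∎

  x^n⁻¹≈x⁻¹^n : ∀ {x} n → x ≉ 0# → pow F x n ⁻¹ ≈ pow F (x ⁻¹) n
  x^n⁻¹≈x⁻¹^n n x≉0 = sym (inverse-unique (x^n*x⁻¹^n≈1 n x≉0))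

  sumTo-cong : ∀ k {f g : ℕ → Carrier} → (∀ j → f j ≈ g j) → sumTo F k f ≈ sumTo F k g
  sumTo-cong zero    f≈g = f≈g 0
  sumTo-cong (suc k) f≈g = +-cong (sumTo-cong k f≈g) (f≈g (suc k))

  sumTo-+ : ∀ k (f g : ℕ → Carrier) → sumTo F k (λ j → f j + g j) ≈ sumTo F k f + sumTo F k g
  sumTo-+ zero    f g = refl
  sumTo-+ (suc k) f g = trans (+-congʳ (sumTo-+ k f g)) (+-interchange _ _ _ _)

  sumTo-*ˡ : ∀ k x (f : ℕ → Carrier) → sumTo F k (λ j → x * f j) ≈ x * sumTo F k f
  sumTo-*ˡ zero    x f = refl
  sumTo-*ˡ (suc k) x f = trans (+-congʳ (sumTo-*ˡ k x f)) (sym (distribˡ x _ _))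

  sumTo-suc : ∀ k (f : ℕ → Carrier) → sumTo F (suc k) f ≈ f 0 + sumTo F k (λ j → f (suc j))
  sumTo-suc zero    f = refl
  sumTo-suc (suc k) f = trans (+-congʳ (sumTo-suc k f)) (+-assoc _ _ _)

  ι-+ : ∀ m n → ι F (m ℕ.+ n) ≈ ι F m + ι F n
  ι-+ zero    n = sym (+-identityˡ _)
  ι-+ (suc m) n = trans (+-congˡ (ι-+ m n)) (sym (+-assoc _ _ _))

  binom-pascal : ∀ k j → binom F (suc k) (suc j) ≈ binom F k j + binom F k (suc j)
  binom-pascal k j =
    trans (reflexive (≡.cong (ι F) (≡.sym (nCk+nC[k+1]≡[n+1]C[k+1] k j)))) (ι-+ (k C j) (k C suc j))

  binom-n-[1+n]≈0 : ∀ k → binom F k (suc k) ≈ 0#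
  binom-n-[1+n]≈0 k = reflexive (≡.cong (ι F) (k>n⇒nCk≡0 (ℕP.n<1+n k)))

  sumTo-binom-suc : ∀ k (h : ℕ → Carrier) →
    sumTo F (suc k) (λ j → binom F (suc k) j * h j)
      ≈ sumTo F k (λ j → binom F k j * h j) + sumTo F k (λ j → binom F k j * h (suc j))
  sumTo-binom-suc k h = begin
    sumTo F (suc k) (λ j → binom F (suc k) j * h j)
      ≈⟨ sumTo-suc k _ ⟩
    binom F k 0 * h 0 + sumTo F k (λ j → binom F (suc k) (suc j) * h (suc j))
      ≈⟨ +-congˡ (sumTo-cong k (λ j → trans (*-congʳ (binom-pascal k j)) (distribʳ _ _ _))) ⟩
    binom F k 0 * h 0 + sumTo F k (λ j → binom F k j * h (suc j) + binom F k (suc j) * h (suc j))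
      ≈⟨ +-congˡ (sumTo-+ k _ _) ⟩
    binom F k 0 * h 0 + (A + B)
      ≈⟨ solve 3 (λ x a b → x :+ (a :+ b) := (x :+ b) :+ a) refl _ A B ⟩
    (binom F k 0 * h 0 + B) + A
      ≈⟨ +-congʳ (sumTo-suc k (λ j → binom F k j * h j)) ⟨
    (sumTo F k (λ j → binom F k j * h j) + binom F k (suc k) * h (suc k)) + A
      ≈⟨ +-congʳ (+-congˡ (trans (*-congʳ (binom-n-[1+n]≈0 k)) (zeroˡ _))) ⟩
    (sumTo F k (λ j → binom F k j * h j) + 0#) + A
      ≈⟨ +-congʳ (+-identityʳ _) ⟩
    sumTo F k (λ j → binom F k j * h j) + A
      ∎
    where
    A = sumTo F k (λ j → binom F k j * h (suc j))
    B = sumTo F k (λ j → binom F k (suc j) * h (suc j))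

  module _ (g : ℤ → Carrier) (s t : ℤ) (c d : Carrier)
           (step : ∀ n → g n + c * g (n ℤ.+ s) ≈ d * g (n ℤ.+ t)) where

    binomial-shift : ∀ k n →
      sumTo F k (λ j → binom F k j * (pow F c j * g (n ℤ.+ s ℤ.* + j))) ≈ pow F d k * g (n ℤ.+ t ℤ.* + k)
    binomial-shift zero n = begin
      (1# + 0#) * (1# * g (n ℤ.+ s ℤ.* + 0)) ≈⟨ *-cong (+-identityʳ 1#) (*-congˡ (reflexive (≡.cong g (no-shift n s)))) ⟩
      1# * (1# * g n)                        ≈⟨ *-identityˡ _ ⟩
      1# * g n                               ≈⟨ *-congˡ (reflexive (≡.cong g (no-shift n t))) ⟨
      1# * g (n ℤ.+ t ℤ.* + 0)               ∎
      where
      no-shift : ∀ n s → n ℤ.+ s ℤ.* + 0 ≡ n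
      no-shift = solve-∀
    binomial-shift (suc k) n = begin
      sumTo F (suc k) (λ j → binom F (suc k) j * (pow F c j * g (n ℤ.+ s ℤ.* + j)))
        ≈⟨ sumTo-binom-suc k (λ j → pow F c j * g (n ℤ.+ s ℤ.* + j)) ⟩
      T n + sumTo F k (λ j → binom F k j * ((c * pow F c j) * g (n ℤ.+ s ℤ.* + suc j)))
        ≈⟨ +-congˡ (sumTo-cong k λ j → begin
             binom F k j * ((c * pow F c j) * g (n ℤ.+ s ℤ.* + suc j))
               ≈⟨ *-congˡ (*-congˡ (reflexive (≡.cong g (shift-one n s (+ j))))) ⟩
             binom F k j * ((c * pow F c j) * g ((n ℤ.+ s) ℤ.+ s ℤ.* + j))
               ≈⟨ solve 4 (λ b c p x → b :* ((c :* p) :* x) := c :* (b :* (p :* x))) refl _ _ _ _ ⟩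
             c * (binom F k j * (pow F c j * g ((n ℤ.+ s) ℤ.+ s ℤ.* + j))) ∎) ⟩
      T n + sumTo F k (λ j → c * (binom F k j * (pow F c j * g ((n ℤ.+ s) ℤ.+ s ℤ.* + j))))
        ≈⟨ +-congˡ (sumTo-*ˡ k c _) ⟩
      T n + c * T (n ℤ.+ s)
        ≈⟨ +-cong (binomial-shift k n) (*-congˡ (binomial-shift k (n ℤ.+ s))) ⟩
      pow F d k * g N + c * (pow F d k * g ((n ℤ.+ s) ℤ.+ t ℤ.* + k))
        ≈⟨ +-congˡ (*-congˡ (*-congˡ (reflexive (≡.cong g (swap-shifts n s t (+ k)))))) ⟩
      pow F d k * g N + c * (pow F d k * g (N ℤ.+ s))
        ≈⟨ solve 4 (λ D x c y → D :* x :+ c :* (D :* y) := D :* (x :+ c :* y)) refl _ _ _ _ ⟩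
      pow F d k * (g N + c * g (N ℤ.+ s))
        ≈⟨ *-congˡ (step N) ⟩
      pow F d k * (d * g (N ℤ.+ t))
        ≈⟨ solve 3 (λ D d x → D :* (d :* x) := (d :* D) :* x) refl _ _ _ ⟩
      (d * pow F d k) * g (N ℤ.+ t)
        ≈⟨ *-congˡ (reflexive (≡.cong g (≡.sym (≡.trans (shift-one n t (+ k)) (swap-shifts n t t (+ k)))))) ⟩
      pow F d (suc k) * g (n ℤ.+ t ℤ.* + suc k)
        ∎
      where
      T : ℤ → Carrier
      T m = sumTo F k (λ j → binom F k j * (pow F c j * g (m ℤ.+ s ℤ.* + j)))
      N = n ℤ.+ t ℤ.* + k
      shift-one : ∀ n s j → n ℤ.+ s ℤ.* (+ 1 ℤ.+ j) ≡ (n ℤ.+ s) ℤ.+ s ℤ.* j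
      shift-one = solve-∀
      swap-shifts : ∀ n s t j → (n ℤ.+ s) ℤ.+ t ℤ.* j ≡ (n ℤ.+ t ℤ.* j) ℤ.+ s
      swap-shifts = solve-∀

  module _ (p q : Carrier) (q≉0 : q ≉ 0#) where

    Recurrent : (ℤ → Carrier) → Set ℓ₂
    Recurrent f = ∀ n → f (ℤ.suc (ℤ.suc n)) ≈ p * f (ℤ.suc n) - q * f n

    backward-step : ∀ x y → y ≈ p * x - q * _÷_ F (p * x - y) q
    backward-step x y = begin
      y                               ≈⟨ solve 2 (λ z y → y := z :- (z :- y)) refl (p * x) y ⟩
      p * x - (p * x - y)             ≈⟨ +-congˡ (-‿cong (x*[y÷x]≈y (p * x - y) q≉0)) ⟨
      p * x - q * _÷_ F (p * x - y) q ∎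

    w-recurrent : ∀ a b → Recurrent (w F a b p q)
    w-recurrent a b (+ n)              = refl
    w-recurrent a b -[1+ 0 ]           = backward-step a b
    w-recurrent a b -[1+ 1 ]           = backward-step (w F a b p q -[1+ 0 ]) a
    w-recurrent a b -[1+ suc (suc n) ] = backward-step (w F a b p q -[1+ suc n ]) (w F a b p q -[1+ n ])

    recurrent-backward : ∀ {f} → Recurrent f → ∀ n → q * f n ≈ p * f (ℤ.suc n) - f (ℤ.suc (ℤ.suc n))
    recurrent-backward {f} rec n = begin
      q * f n                                       ≈⟨ solve 2 (λ x y → y := x :- (x :- y)) refl (p * f (ℤ.suc n)) (q * f n) ⟩
      p * f (ℤ.suc n) - (p * f (ℤ.suc n) - q * f n) ≈⟨ +-congˡ (-‿cong (rec n)) ⟨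
      p * f (ℤ.suc n) - f (ℤ.suc (ℤ.suc n))         ∎

    recurrent-unique : ∀ {f g} → Recurrent f → Recurrent g →
                       f (+ 0) ≈ g (+ 0) → f (+ 1) ≈ g (+ 1) → ∀ n → f n ≈ g n
    recurrent-unique {f} {g} rec-f rec-g f0≈g0 f1≈g1 n = proj₁ (agree n)
      where
      Agree : ℤ → Set ℓ₂
      Agree n = f n ≈ g n × f (ℤ.suc n) ≈ g (ℤ.suc n)

      forward : ∀ n → Agree n → Agree (ℤ.suc n)
      forward n (e₀ , e₁) = e₁ , (begin
        f (ℤ.suc (ℤ.suc n))           ≈⟨ rec-f n ⟩
        p * f (ℤ.suc n) - q * f n     ≈⟨ +-cong (*-congˡ e₁) (-‿cong (*-congˡ e₀)) ⟩
        p * g (ℤ.suc n) - q * g n     ≈⟨ rec-g n ⟨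
        g (ℤ.suc (ℤ.suc n))           ∎)

      backward : ∀ n → Agree (ℤ.suc n) → Agree n
      backward n (e₁ , e₂) = *-cancelˡ-≉0 q≉0 (begin
        q * f n                                ≈⟨ recurrent-backward rec-f n ⟩
        p * f (ℤ.suc n) - f (ℤ.suc (ℤ.suc n))  ≈⟨ +-cong (*-congˡ e₁) (-‿cong e₂) ⟩
        p * g (ℤ.suc n) - g (ℤ.suc (ℤ.suc n))  ≈⟨ recurrent-backward rec-g n ⟨
        q * g n                                ∎) , e₁

      -- ℤ.suc -[1+ 0 ] and ℤ.suc -[1+ suc n ] compute to + 0 and -[1+ n ].
      agree : ∀ n → Agree n
      agree (+ 0)        = f0≈g0 , f1≈g1
      agree (+ suc n)    = forward (+ n) (agree (+ n))
      agree -[1+ 0 ]     = backward -[1+ 0 ] (agree (+ 0))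
      agree -[1+ suc n ] = backward -[1+ suc n ] (agree -[1+ n ])

    recurrent-shift : ∀ {f} → Recurrent f → ∀ m → Recurrent (λ i → f (i ℤ.+ m))
    recurrent-shift {f} rec m n = begin
      f (ℤ.suc (ℤ.suc n) ℤ.+ m)                       ≈⟨ reflexive (≡.cong f (≡.trans (suc-+ (ℤ.suc n) m) (≡.cong ℤ.suc (suc-+ n m)))) ⟩
      f (ℤ.suc (ℤ.suc (n ℤ.+ m)))                     ≈⟨ rec (n ℤ.+ m) ⟩
      p * f (ℤ.suc (n ℤ.+ m)) - q * f (n ℤ.+ m)       ≈⟨ +-congʳ (*-congˡ (reflexive (≡.cong f (suc-+ n m)))) ⟨
      p * f (ℤ.suc n ℤ.+ m) - q * f (n ℤ.+ m)         ∎
      where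
      suc-+ : ∀ i m → ℤ.suc i ℤ.+ m ≡ ℤ.suc (i ℤ.+ m)
      suc-+ i m = ℤP.+-assoc (+ 1) i m

    recurrent-linear : ∀ {f g} → Recurrent f → Recurrent g → ∀ x y → Recurrent (λ i → f i * x - g i * y)
    recurrent-linear {f} {g} rec-f rec-g x y n = begin
      f (ℤ.suc (ℤ.suc n)) * x - g (ℤ.suc (ℤ.suc n)) * y
        ≈⟨ +-cong (*-congʳ (rec-f n)) (-‿cong (*-congʳ (rec-g n))) ⟩
      (p * f₁ - q * f₀) * x - (p * g₁ - q * g₀) * y
        ≈⟨ solve 8 (λ p q f₀ f₁ g₀ g₁ x y →
             (p :* f₁ :- q :* f₀) :* x :- (p :* g₁ :- q :* g₀) :* y
               := p :* (f₁ :* x :- g₁ :* y) :- q :* (f₀ :* x :- g₀ :* y)) refl p q f₀ f₁ g₀ g₁ x y ⟩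
      p * (f₁ * x - g₁ * y) - q * (f₀ * x - g₀ * y)
        ∎
      where
      f₀ = f n
      f₁ = f (ℤ.suc n)
      g₀ = g n
      g₁ = g (ℤ.suc n)

    u-1≈0 : u F p q -[1+ 0 ] ≈ 0#
    u-1≈0 = begin
      (p * 1# - p) * q ⁻¹   ≈⟨ *-congʳ (+-congʳ (*-identityʳ p)) ⟩
      (p - p) * q ⁻¹        ≈⟨ *-congʳ (-‿inverseʳ p) ⟩
      0# * q ⁻¹             ≈⟨ zeroˡ _ ⟩
      0#                    ∎

    w-addition : ∀ a b m i →
      w F a b p q (i ℤ.+ ℤ.suc m)
        ≈ u F p q i * w F a b p q (ℤ.suc m) - u F p q (i ℤ.- + 1) * (q * w F a b p q m)
    w-addition a b m = recurrent-unique
      (recurrent-shift (w-recurrent a b) (ℤ.suc m))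
      (recurrent-linear (w-recurrent 1# p) (recurrent-shift (w-recurrent 1# p) -[1+ 0 ]) _ _)
      at-0 at-1
      where
      W = w F a b p q
      at-0 : W (+ 0 ℤ.+ ℤ.suc m) ≈ 1# * W (ℤ.suc m) - u F p q -[1+ 0 ] * (q * W m)
      at-0 = begin
        W (+ 0 ℤ.+ ℤ.suc m)                                ≡⟨ ≡.cong W (ℤP.+-identityˡ (ℤ.suc m)) ⟩
        W (ℤ.suc m)                                        ≈⟨ solve 2 (λ x y → x := x :- con 0ℤ :* y) refl (W (ℤ.suc m)) (q * W m) ⟩
        W (ℤ.suc m) - 0# * (q * W m)                       ≈⟨ +-cong (*-identityˡ _) (-‿cong (*-congʳ u-1≈0)) ⟨
        1# * W (ℤ.suc m) - u F p q -[1+ 0 ] * (q * W m)    ∎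
      at-1 : W (ℤ.suc (ℤ.suc m)) ≈ p * W (ℤ.suc m) - 1# * (q * W m)
      at-1 = trans (w-recurrent a b m) (+-congˡ (-‿cong (sym (*-identityˡ _))))

    module _ (a b : Carrier) where
      private
        W = w F a b p q
        U = u F p q

      w-step₁ : ∀ r → U (r ℤ.- + 1) ≉ 0# → ∀ n →
        W n + (- _÷_ F (U r) (q * U (r ℤ.- + 1))) * W (n ℤ.+ + 1)
          ≈ (- (q * U (r ℤ.- + 1))) ⁻¹ * W (n ℤ.+ (r ℤ.+ + 1))
      w-step₁ r v≉0 n = x*y≈z⇒y≈x⁻¹*z (-‿≉0 y≉0) (begin
        - y * (W n + (- _÷_ F (U r) y) * W (n ℤ.+ + 1))
          ≈⟨ solve 6 (λ q v uᵣ e A B → (:- (q :* v)) :* (A :+ (:- (uᵣ :* e)) :* B)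
                                        := uᵣ :* B :* ((q :* v) :* e) :- v :* (q :* A))
                     refl q (U (r ℤ.- + 1)) (U r) (y ⁻¹) (W n) (W (n ℤ.+ + 1)) ⟩
        U r * W (n ℤ.+ + 1) * (y * y ⁻¹) - U (r ℤ.- + 1) * (q * W n)
          ≈⟨ +-congʳ (trans (*-congˡ (inverseʳ y y≉0)) (*-identityʳ _)) ⟩
        U r * W (n ℤ.+ + 1) - U (r ℤ.- + 1) * (q * W n)
          ≡⟨ ≡.cong (λ i → U r * W i - U (r ℤ.- + 1) * (q * W n)) (ℤP.+-comm n (+ 1)) ⟩
        U r * W (ℤ.suc n) - U (r ℤ.- + 1) * (q * W n)
          ≈⟨ w-addition a b n r ⟨
        W (r ℤ.+ ℤ.suc n)
          ≡⟨ ≡.cong W (reindex n r) ⟩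
        W (n ℤ.+ (r ℤ.+ + 1))
          ∎)
        where
        y = q * U (r ℤ.- + 1)
        y≉0 = *-≉0 q≉0 v≉0
        reindex : ∀ n r → r ℤ.+ (+ 1 ℤ.+ n) ≡ n ℤ.+ (r ℤ.+ + 1)
        reindex = solve-∀

      w-step₂ : ∀ r → U (r ℤ.- + 2) ≉ 0# → ∀ n →
        W n + (q * U (r ℤ.- + 2)) ⁻¹ * W (n ℤ.+ r)
          ≈ _÷_ F (U (r ℤ.- + 1)) (q * U (r ℤ.- + 2)) * W (n ℤ.+ + 1)
      w-step₂ r v≉0 n = trans (x*y≈z⇒y≈x⁻¹*z y≉0 (begin
        y * (W n + y ⁻¹ * W (n ℤ.+ r))
          ≈⟨ solve 4 (λ y e A B → y :* (A :+ e :* B) := y :* A :+ B :* (y :* e)) refl y (y ⁻¹) (W n) (W (n ℤ.+ r)) ⟩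
        y * W n + W (n ℤ.+ r) * (y * y ⁻¹)
          ≈⟨ +-congˡ (trans (*-congˡ (inverseʳ y y≉0)) (*-identityʳ _)) ⟩
        y * W n + W (n ℤ.+ r)
          ≡⟨ ≡.cong (λ i → y * W n + W i) (reindex n r) ⟩
        y * W n + W ((r ℤ.- + 1) ℤ.+ ℤ.suc n)
          ≈⟨ +-congˡ (w-addition a b n (r ℤ.- + 1)) ⟩
        y * W n + (U (r ℤ.- + 1) * W (ℤ.suc n) - U ((r ℤ.- + 1) ℤ.- + 1) * (q * W n))
          ≡⟨ ≡.cong (λ i → y * W n + (U (r ℤ.- + 1) * W (ℤ.suc n) - U i * (q * W n))) (r-1-1 r) ⟩
        q * U (r ℤ.- + 2) * W n + (U (r ℤ.- + 1) * W (ℤ.suc n) - U (r ℤ.- + 2) * (q * W n))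
          ≈⟨ solve 4 (λ q v A B → q :* v :* A :+ (B :- v :* (q :* A)) := B)
                     refl q (U (r ℤ.- + 2)) (W n) (U (r ℤ.- + 1) * W (ℤ.suc n)) ⟩
        U (r ℤ.- + 1) * W (ℤ.suc n)
          ≡⟨ ≡.cong (λ i → U (r ℤ.- + 1) * W i) (ℤP.+-comm (+ 1) n) ⟩
        U (r ℤ.- + 1) * W (n ℤ.+ + 1)
          ∎)) (x*yz≈yx*z _ _ _)
        where
        y = q * U (r ℤ.- + 2)
        y≉0 = *-≉0 q≉0 v≉0
        reindex : ∀ n r → n ℤ.+ r ≡ (r ℤ.- + 1) ℤ.+ (+ 1 ℤ.+ n)
        reindex = solve-∀
        r-1-1 : ∀ r → (r ℤ.- + 1) ℤ.- + 1 ≡ r ℤ.- + 2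
        r-1-1 = solve-∀

      w-step₃ : ∀ r → U r ≉ 0# → ∀ n →
        W n + (- U r ⁻¹) * W (n ℤ.+ r) ≈ _÷_ F (q * U (r ℤ.- + 1)) (U r) * W (n ℤ.+ -[1+ 0 ])
      w-step₃ r uᵣ≉0 n = trans (x*y≈z⇒y≈x⁻¹*z uᵣ≉0 (begin
        U r * (W n + (- U r ⁻¹) * W (n ℤ.+ r))
          ≈⟨ solve 4 (λ u e A B → u :* (A :+ (:- e) :* B) := u :* A :- B :* (u :* e)) refl (U r) (U r ⁻¹) (W n) (W (n ℤ.+ r)) ⟩
        U r * W n - W (n ℤ.+ r) * (U r * U r ⁻¹)
          ≈⟨ +-congˡ (-‿cong (trans (*-congˡ (inverseʳ (U r) uᵣ≉0)) (*-identityʳ _))) ⟩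
        U r * W n - W (n ℤ.+ r)
          ≡⟨ ≡.cong (λ i → U r * W n - W i) (reindex n r) ⟩
        U r * W n - W (r ℤ.+ ℤ.suc n′)
          ≈⟨ +-congˡ (-‿cong (w-addition a b n′ r)) ⟩
        U r * W n - (U r * W (ℤ.suc n′) - U (r ℤ.- + 1) * (q * W n′))
          ≡⟨ ≡.cong (λ i → U r * W n - (U r * W i - U (r ℤ.- + 1) * (q * W n′))) (suc-pred n) ⟩
        U r * W n - (U r * W n - U (r ℤ.- + 1) * (q * W n′))
          ≈⟨ solve 4 (λ A v q B → A :- (A :- v :* (q :* B)) := (q :* v) :* B) refl (U r * W n) (U (r ℤ.- + 1)) q (W n′) ⟩
        (q * U (r ℤ.- + 1)) * W n′
          ∎)) (x*yz≈yx*z _ _ _)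
        where
        n′ = n ℤ.+ -[1+ 0 ]
        reindex : ∀ n r → n ℤ.+ r ≡ r ℤ.+ (+ 1 ℤ.+ (n ℤ.+ -[1+ 0 ]))
        reindex = solve-∀
        suc-pred : ∀ n → + 1 ℤ.+ (n ℤ.+ -[1+ 0 ]) ≡ n
        suc-pred = solve-∀

      binomial-identity₁ : ∀ k m r → U (r ℤ.- + 1) ≉ 0# →
        pow F (- (q * U (r ℤ.- + 1))) k
          * sumTo F k (λ j → binom F k j
              * (pow F (- _÷_ F (U r) (q * U (r ℤ.- + 1))) j
              * W ((m ℤ.- (+ k ℤ.* (r ℤ.+ + 1))) ℤ.+ + j)))
          ≈ W m
      binomial-identity₁ k m r v≉0 = begin
        pow F x k * sumTo F k (λ j → binom F k j * (pow F c j * W (n₀ ℤ.+ + j)))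
          ≈⟨ *-congˡ (sumTo-cong k λ j → *-congˡ (*-congˡ (reflexive (≡.cong (λ i → W (n₀ ℤ.+ i)) (≡.sym (ℤP.*-identityˡ (+ j))))))) ⟩
        pow F x k * sumTo F k (λ j → binom F k j * (pow F c j * W (n₀ ℤ.+ + 1 ℤ.* + j)))
          ≈⟨ *-congˡ (binomial-shift W (+ 1) (r ℤ.+ + 1) c (x ⁻¹) (w-step₁ r v≉0) k n₀) ⟩
        pow F x k * (pow F (x ⁻¹) k * W (n₀ ℤ.+ (r ℤ.+ + 1) ℤ.* + k))
          ≈⟨ *-assoc _ _ _ ⟨
        (pow F x k * pow F (x ⁻¹) k) * W (n₀ ℤ.+ (r ℤ.+ + 1) ℤ.* + k)
          ≈⟨ *-cong (x^n*x⁻¹^n≈1 k (-‿≉0 (*-≉0 q≉0 v≉0))) (reflexive (≡.cong W (cancel-shift m (+ k) r))) ⟩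
        1# * W m
          ≈⟨ *-identityˡ _ ⟩
        W m
          ∎
        where
        x = - (q * U (r ℤ.- + 1))
        c = - _÷_ F (U r) (q * U (r ℤ.- + 1))
        n₀ = m ℤ.- (+ k ℤ.* (r ℤ.+ + 1))
        cancel-shift : ∀ m k r → (m ℤ.- k ℤ.* (r ℤ.+ + 1)) ℤ.+ (r ℤ.+ + 1) ℤ.* k ≡ m
        cancel-shift = solve-∀

      binomial-identity₂ : ∀ k m r → U (r ℤ.- + 2) ≉ 0# →
        sumTo F k (λ j → binom F k j
            * _÷_ F (W ((m ℤ.- + k) ℤ.+ (r ℤ.* + j))) (pow F (q * U (r ℤ.- + 2)) j))
          ≈ pow F (_÷_ F (U (r ℤ.- + 1)) (q * U (r ℤ.- + 2))) k * W m
      binomial-identity₂ k m r v≉0 = begin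
        sumTo F k (λ j → binom F k j * (W (n₀ ℤ.+ r ℤ.* + j) * pow F y j ⁻¹))
          ≈⟨ sumTo-cong k (λ j → *-congˡ (trans (*-comm _ _) (*-congʳ (x^n⁻¹≈x⁻¹^n j (*-≉0 q≉0 v≉0))))) ⟩
        sumTo F k (λ j → binom F k j * (pow F (y ⁻¹) j * W (n₀ ℤ.+ r ℤ.* + j)))
          ≈⟨ binomial-shift W r (+ 1) (y ⁻¹) d (w-step₂ r v≉0) k n₀ ⟩
        pow F d k * W (n₀ ℤ.+ + 1 ℤ.* + k)
          ≡⟨ ≡.cong (λ i → pow F d k * W i) (cancel-shift m (+ k)) ⟩
        pow F d k * W m
          ∎
        where
        y = q * U (r ℤ.- + 2)
        d = _÷_ F (U (r ℤ.- + 1)) y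
        n₀ = m ℤ.- + k
        cancel-shift : ∀ m k → (m ℤ.- k) ℤ.+ + 1 ℤ.* k ≡ m
        cancel-shift = solve-∀

      binomial-identity₃ : ∀ k m r → U r ≉ 0# →
        sumTo F k (λ j → (pow F (- 1#) j * binom F k j)
            * _÷_ F (W ((m ℤ.+ + k) ℤ.+ (r ℤ.* + j))) (pow F (U r) j))
          ≈ pow F (_÷_ F (q * U (r ℤ.- + 1)) (U r)) k * W m
      binomial-identity₃ k m r uᵣ≉0 = begin
        sumTo F k (λ j → (pow F (- 1#) j * binom F k j) * (W (n₀ ℤ.+ r ℤ.* + j) * pow F (U r) j ⁻¹))
          ≈⟨ sumTo-cong k term ⟩
        sumTo F k (λ j → binom F k j * (pow F (- e) j * W (n₀ ℤ.+ r ℤ.* + j)))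
          ≈⟨ binomial-shift W r -[1+ 0 ] (- e) d (w-step₃ r uᵣ≉0) k n₀ ⟩
        pow F d k * W (n₀ ℤ.+ -[1+ 0 ] ℤ.* + k)
          ≡⟨ ≡.cong (λ i → pow F d k * W i) (cancel-shift m (+ k)) ⟩
        pow F d k * W m
          ∎
        where
        e = U r ⁻¹
        d = _÷_ F (q * U (r ℤ.- + 1)) (U r)
        n₀ = m ℤ.+ + k
        cancel-shift : ∀ m k → (m ℤ.+ k) ℤ.+ -[1+ 0 ] ℤ.* k ≡ m
        cancel-shift = solve-∀
        term : ∀ j → (pow F (- 1#) j * binom F k j) * (W (n₀ ℤ.+ r ℤ.* + j) * pow F (U r) j ⁻¹)
                     ≈ binom F k j * (pow F (- e) j * W (n₀ ℤ.+ r ℤ.* + j))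
        term j = begin
          (pow F (- 1#) j * binom F k j) * (W (n₀ ℤ.+ r ℤ.* + j) * pow F (U r) j ⁻¹)
            ≈⟨ *-congˡ (*-congˡ (x^n⁻¹≈x⁻¹^n j uᵣ≉0)) ⟩
          (pow F (- 1#) j * binom F k j) * (W (n₀ ℤ.+ r ℤ.* + j) * pow F e j)
            ≈⟨ solve 4 (λ s C A E → (s :* C) :* (A :* E) := C :* ((s :* E) :* A))
                       refl (pow F (- 1#) j) (binom F k j) (W (n₀ ℤ.+ r ℤ.* + j)) (pow F e j) ⟩
          binom F k j * ((pow F (- 1#) j * pow F e j) * W (n₀ ℤ.+ r ℤ.* + j))
            ≈⟨ *-congˡ (*-congʳ (trans (sym (pow-distrib-* (- 1#) e j)) (pow-congˡ j (-1*x≈-x e)))) ⟩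
          binom F k j * (pow F (- e) j * W (n₀ ℤ.+ r ℤ.* + j))
            ∎

theorem8 : {c ℓ : Level} (F : Field c ℓ) →
  let open Field F in
  (a b p q : Carrier) → p ≉ 0# → q ≉ 0# →
  (k : ℕ) (m : ℤ) →
    ((r : ℤ) → r ≢ + 0 → (u F p q (r ℤ.- + 1)) ≉ 0# →
      (pow F (- (q * u F p q (r ℤ.- + 1))) k
        * sumTo F k (λ j → binom F k j
            * (pow F (- _÷_ F (u F p q r) (q * u F p q (r ℤ.- + 1))) j
            * w F a b p q ((m ℤ.- (+ k ℤ.* (r ℤ.+ + 1))) ℤ.+ + j))))
      ≈ w F a b p q m)
    × ((r : ℤ) → r ≢ + 1 → (u F p q (r ℤ.- + 2)) ≉ 0# →
      sumTo F k (λ j → binom F k j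
          * _÷_ F (w F a b p q ((m ℤ.- + k) ℤ.+ (r ℤ.* + j)))
                  (pow F (q * u F p q (r ℤ.- + 2)) j))
      ≈ (pow F (_÷_ F (u F p q (r ℤ.- + 1)) (q * u F p q (r ℤ.- + 2))) k
          * w F a b p q m))
    × ((r : ℤ) → r ≢ -[1+ 0 ] → (u F p q r) ≉ 0# →
      sumTo F k (λ j → (pow F (- 1#) j * binom F k j)
          * _÷_ F (w F a b p q ((m ℤ.+ + k) ℤ.+ (r ℤ.* + j)))
                  (pow F (u F p q r) j))
      ≈ (pow F (_÷_ F (q * u F p q (r ℤ.- + 1)) (u F p q r)) k
          * w F a b p q m))
theorem8 F a b p q _ q≉0 k m =
  (λ r _ → binomial-identity₁ F p q q≉0 a b k m r) ,
  (λ r _ → binomial-identity₂ F p q q≉0 a b k m r) ,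
  (λ r _ → binomial-identity₃ F p q q≉0 a b k m r)
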